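{- For $n\ge1$ let $s(n)$ be the minimal size of a generator/separator set for $\mathcal{E}(n)$, i.e. the minimum of $|\mathcal{S}|$ over $\mathcal{S}\subseteq\mathcal{E}(n)$ such that $x\mapsto(I(g)(x))_{g\in\mathcal{S}}$ is injective on $\mathcal{E}(n)$. Then $s(n)\to\infty$ as $n\to\infty$.
   Context: $\mathcal{E}(n)$ is the set of isomorphism classes of simple graphs on $n$ vertices. For simple graphs $g,x$ on $n$ vertices, $I(g)(x)$ is the number of subgraphs of $x$ (subsets of its edge set) isomorphic to $g$. Separator sets coincide with generator sets here (sets $\mathcal S$ such that every $I(h)$, $h\in\mathcal E(n)$, restricted to $\mathcal E(n)$ is a function of $(I(g))_{g\in\mathcal S}$). -}

module Defs where

open import Data.Nat using (ℕ; zero; suc; _+_)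
open import Data.Bool using (Bool; true; false; _∧_; _∨_; not; if_then_else_; T)
open import Data.Bool.Properties using () renaming (_≟_ to _≟ᵇ_)
open import Data.Unit using (⊤; tt)
open import Data.Product using (Σ; _×_; _,_)
open import Data.Fin using (Fin; zero; suc) renaming (_≟_ to _≟ᶠ_)
open import Data.Fin.Permutation using (Permutation′; _⟨$⟩ʳ_)
open import Data.Vec using (Vec; []; _∷_; lookup; allFin; toList)
open import Data.List using (List; []; _∷_; map; concatMap; length; filterᵇ)
open import Data.Bool.ListAction using (all; any)
open import Relation.Nullary.Decidable using (⌊_⌋)
open import Relation.Binary.PropositionalEquality using (_≡_)

-- A simple graph on the vertex set Fin n, stored canonically (each graph exactly
-- once): a graph on suc n vertices is a graph on the vertices suc i (i : Fin n)
-- together with the adjacency vector of the extra vertex zero to the vertices suc i.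
-- Equivalently: an arbitrary subset of the edge set of the complete graph K_n.
Graph : ℕ → Set
Graph zero    = ⊤
Graph (suc n) = Graph n × Vec Bool n

adj : ∀ {n} → Graph n → Fin n → Fin n → Bool
adj {suc n} (g , v) zero    zero    = false
adj {suc n} (g , v) zero    (suc j) = lookup v j
adj {suc n} (g , v) (suc i) zero    = lookup v i
adj {suc n} (g , v) (suc i) (suc j) = adj g i j

_≅_ : ∀ {n} → Graph n → Graph n → Set
_≅_ {n} g h = Σ (Permutation′ n) λ σ → ∀ i j → adj g i j ≡ adj h (σ ⟨$⟩ʳ i) (σ ⟨$⟩ʳ j)

allVecs : ∀ {A : Set} → List A → (k : ℕ) → List (Vec A k)
allVecs xs zero    = [] ∷ []
allVecs xs (suc k) = concatMap (λ x → map (x ∷_) (allVecs xs k)) xs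

allGraphs : (n : ℕ) → List (Graph n)
allGraphs zero    = tt ∷ []
allGraphs (suc n) = concatMap (λ g → map (g ,_) (allVecs (true ∷ false ∷ []) n)) (allGraphs n)

vertices : (n : ℕ) → List (Fin n)
vertices n = toList (allFin n)

isIso : ∀ {n} → Graph n → Graph n → Bool
isIso {n} g h = any ok (allVecs (vertices n) n)
  where
  ok : Vec (Fin n) n → Bool
  ok σ = all (λ i → all (λ j →
           (not ⌊ lookup σ i ≟ᶠ lookup σ j ⌋ ∨ ⌊ i ≟ᶠ j ⌋)
           ∧ ⌊ adj g i j ≟ᵇ adj h (lookup σ i) (lookup σ j) ⌋) (vertices n)) (vertices n)

isSub : ∀ {n} → Graph n → Graph n → Bool
isSub {n} h x = all (λ i → all (λ j → not (adj h i j) ∨ adj x i j) (vertices n)) (vertices n)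

-- I(g)(x): number of edge subsets F ⊆ E(x) such that the spanning graph ([n], F) ≅ g
I : ∀ {n} → Graph n → Graph n → ℕ
I {n} g x = length (filterᵇ (λ h → isSub h x ∧ isIso h g) (allGraphs n))

-- If S separates the graphs on n vertices, a graph is determined up to isomorphism by its
-- profile (I(g)(x))_{g ∈ S}, so every isomorphism class is a set of at most n^n relabellings
-- of one graph.  On graphs with m edges every I(g) takes values in [0, 2^m], hence a family of
-- such graphs has at most (2^m + 1)^|S| · n^n labelled members.  Take r centres and q blocks
-- of b leaves and join each centre to exactly one leaf of every block: this gives b^(qr)
-- labelled graphs with qr edges each.  With b = 2^(M+1), q = 4t, r = 4tb and
-- t ≈ n/8b, the inequality b^(qr) ≤ (2^(qr) + 1)^|S| · n^n forces |S| ≥ M once t ≥ M + 6.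
module Submission where

open import Defs
open import Data.Bool using (Bool; true; false; not; _∧_; _∨_; T)
open import Data.Bool.Properties using (∨-comm; ∨-identityʳ; ∧-identityʳ; ∧-zeroʳ; ∧-distribʳ-∨; T-≡; T-∧)
open import Data.Bool.ListAction using (all)
open import Data.Fin as Fin using (Fin; zero; suc; splitAt; _↑ˡ_; _↑ʳ_; combine; remQuot)
open import Data.Fin.Properties using (splitAt-↑ˡ; splitAt-↑ʳ; splitAt⁻¹-↑ˡ; splitAt⁻¹-↑ʳ; remQuot-combine; combine-remQuot)
open import Data.Fin.Permutation using (_⟨$⟩ʳ_)
open import Data.List using (List; []; _∷_; length; map; _++_; cartesianProductWith; concatMap)
import Data.List.Properties as List
open import Data.List.Membership.Propositional using (_∈_)
open import Data.List.Membership.Propositional.Properties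
  using (∈-allFin; ∈-cartesianProductWith⁺; ∈-filter⁻; ∈-upTo⁺; ∈-map⁺; ∈-map⁻)
open import Data.List.Relation.Binary.Subset.Propositional using (_⊆_)
open import Data.List.Relation.Unary.All as All using (All; []; _∷_)
open import Data.List.Relation.Unary.Any as Any using (here; there; any?; _─_)
open import Data.List.Relation.Unary.Any.Properties using (lookup-result)
open import Data.List.Relation.Unary.Unique.Propositional using (Unique; []; _∷_)
import Data.List.Relation.Unary.Unique.Propositional.Properties as Unique
open import Data.Nat using (ℕ; zero; suc; _+_; _*_; _^_; _≤_; _<_; z≤n; s≤s; _≟_; _≤?_; NonZero; >-nonZero; _/_; _%_)
open import Data.Nat.DivMod using (m≡m%n+[m/n]*n; m%n<n; m/n*n≤m; m*n/n≡m; /-monoˡ-≤)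
open import Data.Nat.Properties
open import Data.Nat.Tactic.RingSolver using (solve-∀)
open import Data.Product using (∃-syntax; _,_; proj₁; proj₂; uncurry)
open import Data.Sum using (inj₁; inj₂)
open import Data.Product.Properties using (×-≡,≡←≡)
open import Data.Unit using (tt)
open import Data.Vec as Vec using (Vec; []; _∷_; lookup; tabulate)
open import Data.Vec.Properties using (lookup∘tabulate; tabulate∘lookup; tabulate-cong; ∷-injective; lookup-map; ≡-dec)
open import Function using (_∘_; id)
open import Function.Bundles using (Equivalence)
open import Relation.Binary.PropositionalEquality
  using (_≡_; _≢_; refl; sym; trans; cong; cong₂; subst; module ≡-Reasoning)
open import Relation.Nullary using (yes; no; does; contradiction)
open import Relation.Nullary.Decidable using (T?; dec-true; dec-false)

-- Graphs

adj-irrefl : ∀ {n} (g : Graph n) i → adj g i i ≡ false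
adj-irrefl {suc n} (g , v) zero    = refl
adj-irrefl {suc n} (g , v) (suc i) = adj-irrefl g i

adj-sym : ∀ {n} (g : Graph n) i j → adj g i j ≡ adj g j i
adj-sym {suc n} (g , v) zero    zero    = refl
adj-sym {suc n} (g , v) zero    (suc j) = refl
adj-sym {suc n} (g , v) (suc i) zero    = refl
adj-sym {suc n} (g , v) (suc i) (suc j) = adj-sym g i j

fromAdjacency : ∀ {n} → (Fin n → Fin n → Bool) → Graph n
fromAdjacency {zero}  f = tt
fromAdjacency {suc n} f = fromAdjacency (λ i j → f (suc i) (suc j)) , tabulate (λ j → f zero (suc j))

adj-fromAdjacency : ∀ {n} (f : Fin n → Fin n → Bool) →
                    (∀ i j → f i j ≡ f j i) → (∀ i → f i i ≡ false) →
                    ∀ i j → adj (fromAdjacency f) i j ≡ f i j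
adj-fromAdjacency {suc n} f sym-f irr-f zero    zero    = sym (irr-f zero)
adj-fromAdjacency {suc n} f sym-f irr-f zero    (suc j) = lookup∘tabulate _ j
adj-fromAdjacency {suc n} f sym-f irr-f (suc i) zero    = trans (lookup∘tabulate _ i) (sym-f zero (suc i))
adj-fromAdjacency {suc n} f sym-f irr-f (suc i) (suc j) =
  adj-fromAdjacency _ (λ i j → sym-f (suc i) (suc j)) (irr-f ∘ suc) i j

vec-ext : ∀ {A : Set} {k} {u v : Vec A k} → (∀ i → lookup u i ≡ lookup v i) → u ≡ v
vec-ext {u = u} {v} eq = trans (sym (tabulate∘lookup u)) (trans (tabulate-cong eq) (tabulate∘lookup v))

graph-ext : ∀ {n} {x y : Graph n} → (∀ i j → adj x i j ≡ adj y i j) → x ≡ y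
graph-ext {zero}                  eq = refl
graph-ext {suc n} {x , u} {y , v} eq = cong₂ _,_ (graph-ext (λ i j → eq (suc i) (suc j))) (vec-ext (eq zero ∘ suc))

relabel : ∀ {n} → Vec (Fin n) n → Graph n → Graph n
relabel τ y = fromAdjacency (λ i j → adj y (lookup τ i) (lookup τ j))

≅⇒≡relabel : ∀ {n} {x y : Graph n} → x ≅ y → ∃[ τ ] x ≡ relabel τ y
≅⇒≡relabel {x = x} {y} (σ , preserves) = τ , graph-ext λ i j → begin
    adj x i j                                     ≡⟨ preserves i j ⟩
    adj y (σ ⟨$⟩ʳ i) (σ ⟨$⟩ʳ j)                   ≡⟨ cong₂ (adj y) (lookup∘tabulate _ i) (lookup∘tabulate _ j) ⟨
    adj y (lookup τ i) (lookup τ j)               ≡⟨ adj-fromAdjacency _ (λ i j → adj-sym y _ _) (λ i → adj-irrefl y _) i j ⟨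
    adj (relabel τ y) i j                         ∎
  where
  open ≡-Reasoning
  τ : Vec (Fin _) _
  τ = tabulate (σ ⟨$⟩ʳ_)

-- Enumerations

length-cartesianProductWith : ∀ {A B C : Set} (f : A → B → C) xs ys →
                              length (cartesianProductWith f xs ys) ≡ length xs * length ys
length-cartesianProductWith f []       ys = refl
length-cartesianProductWith f (x ∷ xs) ys = begin
  length (map (f x) ys ++ cartesianProductWith f xs ys)  ≡⟨ List.length-++ (map (f x) ys) ⟩
  length (map (f x) ys) + length (cartesianProductWith f xs ys)
    ≡⟨ cong₂ _+_ (List.length-map (f x) ys) (length-cartesianProductWith f xs ys) ⟩
  length ys + length xs * length ys                       ∎
  where open ≡-Reasoning

concatMap-map≡cartesianProductWith : ∀ {A B C : Set} (f : A → B → C) xs ys →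
  concatMap (λ x → map (f x) ys) xs ≡ cartesianProductWith f xs ys
concatMap-map≡cartesianProductWith f []       ys = refl
concatMap-map≡cartesianProductWith f (x ∷ xs) ys =
  cong (map (f x) ys ++_) (concatMap-map≡cartesianProductWith f xs ys)

allVecs-suc : ∀ {A : Set} (xs : List A) k → allVecs xs (suc k) ≡ cartesianProductWith _∷_ xs (allVecs xs k)
allVecs-suc xs k = concatMap-map≡cartesianProductWith _∷_ xs (allVecs xs k)

length-allVecs : ∀ {A : Set} (xs : List A) k → length (allVecs xs k) ≡ length xs ^ k
length-allVecs xs zero    = refl
length-allVecs xs (suc k) rewrite allVecs-suc xs k =
  trans (length-cartesianProductWith _∷_ xs (allVecs xs k)) (cong (length xs *_) (length-allVecs xs k))

∈-allVecs : ∀ {A : Set} {xs : List A} {k} (v : Vec A k) → (∀ i → lookup v i ∈ xs) → v ∈ allVecs xs k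
∈-allVecs             []      _   = here refl
∈-allVecs {xs = xs} {suc k} (x ∷ v) ∈xs rewrite allVecs-suc xs k =
  ∈-cartesianProductWith⁺ _∷_ (∈xs zero) (∈-allVecs v (∈xs ∘ suc))

allVecs⁺ : ∀ {A : Set} {xs : List A} k → Unique xs → Unique (allVecs xs k)
allVecs⁺             zero    _     = [] ∷ []
allVecs⁺ {xs = xs} (suc k) xs! rewrite allVecs-suc xs k =
  Unique.cartesianProductWith⁺ _∷_ ∷-injective xs! (allVecs⁺ k xs!)

allGraphs⁺ : ∀ n → Unique (allGraphs n)
allGraphs⁺ zero    = [] ∷ []
allGraphs⁺ (suc n) = subst Unique (sym (concatMap-map≡cartesianProductWith _,_ (allGraphs n) _))
  (Unique.cartesianProductWith⁺ _,_ ×-≡,≡←≡ (allGraphs⁺ n) (allVecs⁺ n (((λ ()) ∷ []) ∷ [] ∷ [])))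

vertices≡allFin : ∀ n → vertices n ≡ Data.List.allFin n
vertices≡allFin n = toList-tabulate id
  where
  toList-tabulate : ∀ {A : Set} {k} (f : Fin k → A) → Vec.toList (tabulate f) ≡ Data.List.tabulate f
  toList-tabulate {k = zero}  f = refl
  toList-tabulate {k = suc k} f = cong (f zero ∷_) (toList-tabulate (f ∘ suc))

∈-vertices : ∀ {n} (i : Fin n) → i ∈ vertices n
∈-vertices {n} i rewrite vertices≡allFin n = ∈-allFin i

length-vertices : ∀ n → length (vertices n) ≡ n
length-vertices n rewrite vertices≡allFin n = List.length-tabulate id

-- Counting

module _ {A : Set} where

  ∈-─ : ∀ {x y : A} ys (p : x ∈ ys) → y ∈ ys → y ≢ x → y ∈ (ys ─ p)
  ∈-─ (z ∷ ys) (here refl) (here refl) y≢x = contradiction refl y≢x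
  ∈-─ (z ∷ ys) (here refl) (there q)   y≢x = q
  ∈-─ (z ∷ ys) (there p)   (here refl) y≢x = here refl
  ∈-─ (z ∷ ys) (there p)   (there q)   y≢x = there (∈-─ ys p q y≢x)

  length-mono-⊆ : ∀ {xs ys : List A} → Unique xs → xs ⊆ ys → length xs ≤ length ys
  length-mono-⊆ {[]}     _          _    = z≤n
  length-mono-⊆ {x ∷ xs} {ys} (x∉xs ∷ xs!) xs⊆ys =
    ≤-trans (s≤s (length-mono-⊆ xs! λ y∈xs → ∈-─ ys x∈ys (xs⊆ys (there y∈xs)) (≢x y∈xs)))
            (≤-reflexive (sym (List.length-removeAt′ ys (Any.index x∈ys))))
    where
    x∈ys : x ∈ ys
    x∈ys = xs⊆ys (here refl)
    ≢x : ∀ {y} → y ∈ xs → y ≢ x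
    ≢x y∈xs refl = All.lookup x∉xs y∈xs refl

T-all : ∀ {A : Set} (p : A → Bool) {xs x} → T (all p xs) → x ∈ xs → T (p x)
T-all p {y ∷ ys} t (here refl) = proj₁ (Equivalence.to T-∧ t)
T-all p {y ∷ ys} t (there x∈ys) = T-all p (proj₂ (Equivalence.to T-∧ t)) x∈ys

∧-absorbs-implied : ∀ {a b} → (a ≡ true → b ≡ true) → b ∧ a ≡ a
∧-absorbs-implied {false} {b} _    = ∧-zeroʳ b
∧-absorbs-implied {true}  {b} a⇒b = cong (_∧ true) (a⇒b refl)

isSub⇒adj : ∀ {n} {h x : Graph n} → T (isSub h x) → ∀ i j → adj h i j ≡ true → adj x i j ≡ true
isSub⇒adj h⊆x i j =
  Equivalence.to T-≡ ∘ modusPonens (T-all _ (T-all _ h⊆x (∈-vertices i)) (∈-vertices j))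
  where
  modusPonens : ∀ {a b} → T (not a ∨ b) → a ≡ true → T b
  modusPonens t refl = t

I≤length : ∀ {n} {g x : Graph n} hs → (∀ h → T (isSub h x) → h ∈ hs) → I g x ≤ length hs
I≤length {n} {g} {x} hs covers = length-mono-⊆ (Unique.filter⁺ (T? ∘ p) (allGraphs⁺ n))
  λ h∈ → covers _ (proj₁ (Equivalence.to T-∧ (proj₂ (∈-filter⁻ (T? ∘ p) {xs = allGraphs n} h∈))))
  where
  p : Graph n → Bool
  p h = isSub h x ∧ isIso h g

Separating : ∀ {n} → List (Graph n) → Set
Separating {n} S = (x y : Graph n) → All (λ g → I g x ≡ I g y) S → x ≅ y

profile : ∀ {n} (S : List (Graph n)) → Graph n → Vec ℕ (length S)
profile S x = Vec.map (λ g → I g x) (Vec.fromList S)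

profile-≡⇒All : ∀ {n} (S : List (Graph n)) {x y} → profile S x ≡ profile S y → All (λ g → I g x ≡ I g y) S
profile-≡⇒All []      _  = []
profile-≡⇒All (g ∷ S) eq = proj₁ (∷-injective eq) ∷ profile-≡⇒All S (proj₂ (∷-injective eq))

module _ {n} (S : List (Graph n)) (L : List (Graph n)) where

  representative : Vec ℕ (length S) → Graph n
  representative v with any? (λ y → ≡-dec _≟_ (profile S y) v) L
  ... | yes y∈L = Any.lookup y∈L
  ... | no  _   = fromAdjacency (λ _ _ → false)

  profile-representative : ∀ {x} → x ∈ L → profile S (representative (profile S x)) ≡ profile S x
  profile-representative {x} x∈L with any? (λ y → ≡-dec _≟_ (profile S y) (profile S x)) L
  ... | yes y∈L = lookup-result y∈L
  ... | no  ∉L  = contradiction (Any.map (λ x≡y → cong (profile S) (sym x≡y)) x∈L) ∉L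

separating⇒length≤ : ∀ {n} {S L : List (Graph n)} {B} → Separating S → Unique L →
                     (∀ {x} → x ∈ L → ∀ g → I g x ≤ B) →
                     length L ≤ suc B ^ length S * n ^ n
separating⇒length≤ {n} {S} {L} {B} separates L! bounded = begin
  length L                ≤⟨ length-mono-⊆ L! L⊆K ⟩
  length K                ≡⟨ length-cartesianProductWith copy profiles relabellings ⟩
  length profiles * length relabellings
    ≡⟨ cong₂ _*_ (trans (length-allVecs _ (length S)) (cong (_^ length S) (List.length-upTo (suc B))))
                 (trans (length-allVecs _ n) (cong (_^ n) (length-vertices n))) ⟩
  suc B ^ length S * n ^ n ∎
  where
  open ≤-Reasoning
  profiles : List (Vec ℕ (length S))
  profiles = allVecs (Data.List.upTo (suc B)) (length S)
  relabellings : List (Vec (Fin n) n)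
  relabellings = allVecs (vertices n) n
  copy : Vec ℕ (length S) → Vec (Fin n) n → Graph n
  copy v τ = relabel τ (representative S L v)
  K : List (Graph n)
  K = cartesianProductWith copy profiles relabellings
  L⊆K : L ⊆ K
  L⊆K {x} x∈L with ≅⇒≡relabel (separates x _ (profile-≡⇒All S (sym (profile-representative S L x∈L))))
  ... | τ , x≡copy = subst (_∈ K) (sym x≡copy) (∈-cartesianProductWith⁺ copy
          (∈-allVecs _ λ i → subst (_∈ _) (sym (lookup-map i _ (Vec.fromList S))) (∈-upTo⁺ (s≤s (bounded x∈L _))))
          (∈-allVecs τ (∈-vertices ∘ lookup τ)))

Matrix : Set → ℕ → ℕ → Set
Matrix A r q = Vec (Vec A q) r

module _ {A : Set} {r q : ℕ} where

  entry : Matrix A r q → Fin r → Fin q → A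
  entry m a j = lookup (lookup m a) j

  matrix : (Fin r → Fin q → A) → Matrix A r q
  matrix f = tabulate (λ a → tabulate (f a))

  entry-matrix : ∀ f a j → entry (matrix f) a j ≡ f a j
  entry-matrix f a j rewrite lookup∘tabulate (λ a → tabulate (f a)) a = lookup∘tabulate (f a) j

  matrix-ext : ∀ {m m′ : Matrix A r q} → (∀ a j → entry m a j ≡ entry m′ a j) → m ≡ m′
  matrix-ext eq = vec-ext λ a → vec-ext (eq a)

  allMatrices : List A → List (Matrix A r q)
  allMatrices xs = allVecs (allVecs xs q) r

  ∈-allMatrices : ∀ {xs} (m : Matrix A r q) → (∀ a j → entry m a j ∈ xs) → m ∈ allMatrices xs
  ∈-allMatrices m ∈xs = ∈-allVecs m λ a → ∈-allVecs (lookup m a) (∈xs a)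

  length-allMatrices : ∀ xs → length (allMatrices xs) ≡ length xs ^ (q * r)
  length-allMatrices xs = begin
    length (allVecs (allVecs xs q) r) ≡⟨ length-allVecs (allVecs xs q) r ⟩
    length (allVecs xs q) ^ r         ≡⟨ cong (_^ r) (length-allVecs xs q) ⟩
    (length xs ^ q) ^ r               ≡⟨ ^-*-assoc (length xs) q r ⟩
    length xs ^ (q * r)               ∎
    where open ≡-Reasoning

  allMatrices⁺ : ∀ {xs} → Unique xs → Unique (allMatrices xs)
  allMatrices⁺ xs! = allVecs⁺ r (allVecs⁺ q xs!)

-- The star family

module Star (r q b e : ℕ) where

  data Vertex : Set where
    centre : Fin r → Vertex
    leaf   : Fin q → Fin b → Vertex
    spare  : Fin e → Vertex

  decode : Fin (r + q * b + e) → Vertex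
  decode i with splitAt (r + q * b) i
  ... | inj₂ s = spare s
  ... | inj₁ k with splitAt r k
  ...   | inj₁ a = centre a
  ...   | inj₂ h = uncurry leaf (remQuot b h)

  encode : Vertex → Fin (r + q * b + e)
  encode (centre a) = (a ↑ˡ q * b) ↑ˡ e
  encode (leaf j β) = (r ↑ʳ combine j β) ↑ˡ e
  encode (spare s)  = (r + q * b) ↑ʳ s

  decode-encode : ∀ v → decode (encode v) ≡ v
  decode-encode (centre a)
    rewrite splitAt-↑ˡ (r + q * b) (a ↑ˡ q * b) e | splitAt-↑ˡ r a (q * b) = refl
  decode-encode (leaf j β)
    rewrite splitAt-↑ˡ (r + q * b) (r ↑ʳ combine j β) e | splitAt-↑ʳ r (q * b) (combine j β)
    = cong (uncurry leaf) (remQuot-combine j β)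
  decode-encode (spare s) rewrite splitAt-↑ʳ (r + q * b) e s = refl

  encode-decode : ∀ i → encode (decode i) ≡ i
  encode-decode i with splitAt (r + q * b) i in eq
  ... | inj₂ s = splitAt⁻¹-↑ʳ eq
  ... | inj₁ k with splitAt r k in eq′
  ...   | inj₁ a = trans (cong (_↑ˡ e) (splitAt⁻¹-↑ˡ eq′)) (splitAt⁻¹-↑ˡ eq)
  ...   | inj₂ h = trans (cong (λ h → (r ↑ʳ h) ↑ˡ e) (combine-remQuot {q} b h))
                         (trans (cong (_↑ˡ e) (splitAt⁻¹-↑ʳ eq′)) (splitAt⁻¹-↑ˡ eq))

  Code : Set
  Code = Matrix (Fin b) r q

  -- star c s has an edge from centre a to the leaf (j , entry c a j) iff entry s a j; the graphs
  -- star c s are exactly the subgraphs of star c full.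
  Marking : Set
  Marking = Matrix Bool r q

  arc : Code → Marking → Vertex → Vertex → Bool
  arc c s (centre a) (leaf j β) = does (entry c a j Fin.≟ β) ∧ entry s a j
  arc c s _          _          = false

  arc-irrefl : ∀ c s v → arc c s v v ≡ false
  arc-irrefl c s (centre a) = refl
  arc-irrefl c s (leaf j β) = refl
  arc-irrefl c s (spare x)  = refl

  starAdjacency : Code → Marking → Vertex → Vertex → Bool
  starAdjacency c s v w = arc c s v w ∨ arc c s w v

  star : Code → Marking → Graph (r + q * b + e)
  star c s = fromAdjacency λ u v → starAdjacency c s (decode u) (decode v)

  adj-star : ∀ c s v w → adj (star c s) (encode v) (encode w) ≡ starAdjacency c s v w
  adj-star c s v w =
    trans (adj-fromAdjacency _ (λ u u′ → ∨-comm (arc c s (decode u) (decode u′)) _)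
                               (λ u → cong (λ x → x ∨ x) (arc-irrefl c s (decode u))) (encode v) (encode w))
          (cong₂ (starAdjacency c s) (decode-encode v) (decode-encode w))

  full : Marking
  full = matrix λ _ _ → true

  adj-full-centre-leaf : ∀ c a j β → adj (star c full) (encode (centre a)) (encode (leaf j β)) ≡ does (entry c a j Fin.≟ β)
  adj-full-centre-leaf c a j β rewrite adj-star c full (centre a) (leaf j β) | entry-matrix (λ _ _ → true) a j =
    trans (∨-identityʳ _) (∧-identityʳ _)

  star-injective : ∀ {c d} → star c full ≡ star d full → c ≡ d
  star-injective {c} {d} eq = matrix-ext agree
    where
    agree : ∀ a j → entry c a j ≡ entry d a j
    agree a j with entry c a j Fin.≟ entry d a j
    ... | yes c≡d = c≡d
    ... | no  c≢d = contradiction (begin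
      true                                                                  ≡⟨ dec-true (entry d a j Fin.≟ entry d a j) refl ⟨
      does (entry d a j Fin.≟ entry d a j)                                  ≡⟨ adj-full-centre-leaf d a j _ ⟨
      adj (star d full) (encode (centre a)) (encode (leaf j (entry d a j))) ≡⟨ cong (λ x → adj x _ _) eq ⟨
      adj (star c full) (encode (centre a)) (encode (leaf j (entry d a j))) ≡⟨ adj-full-centre-leaf c a j _ ⟩
      does (entry c a j Fin.≟ entry d a j)                                  ≡⟨ dec-false (entry c a j Fin.≟ entry d a j) c≢d ⟩
      false                                                                 ∎) λ ()
      where open ≡-Reasoning

  marking : Code → Graph (r + q * b + e) → Marking
  marking c h = matrix λ a j → adj h (encode (centre a)) (encode (leaf j (entry c a j)))

  arc-marking : ∀ c h v w → arc c (marking c h) v w ≡ arc c full v w ∧ adj h (encode v) (encode w)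
  arc-marking c h (centre a) (leaf j β) with entry c a j Fin.≟ β
  ... | yes refl rewrite entry-matrix (λ _ _ → true) a j = entry-matrix _ a j
  ... | no  _    = refl
  arc-marking c h (centre a) (centre _) = refl
  arc-marking c h (centre a) (spare _)  = refl
  arc-marking c h (leaf j β) w          = refl
  arc-marking c h (spare x)  w          = refl

  subgraph-of-star : ∀ {c h} → T (isSub h (star c full)) → h ≡ star c (marking c h)
  subgraph-of-star {c} {h} h⊆star = graph-ext λ u v → begin
    adj h u v                                   ≡⟨ cong₂ (adj h) (encode-decode u) (encode-decode v) ⟨
    adj h (encode (decode u)) (encode (decode v)) ≡⟨ on-encodings (decode u) (decode v) ⟩
    adj (star c (marking c h)) (encode (decode u)) (encode (decode v))
      ≡⟨ cong₂ (adj (star c (marking c h))) (encode-decode u) (encode-decode v) ⟩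
    adj (star c (marking c h)) u v              ∎
    where
    open ≡-Reasoning
    on-encodings : ∀ v w → adj h (encode v) (encode w) ≡ adj (star c (marking c h)) (encode v) (encode w)
    on-encodings v w = begin
      A                                                           ≡⟨ ∧-absorbs-implied in-star ⟨
      starAdjacency c full v w ∧ A                               ≡⟨ ∧-distribʳ-∨ A (arc c full v w) (arc c full w v) ⟩
      (arc c full v w ∧ A) ∨ (arc c full w v ∧ A)
        ≡⟨ cong₂ _∨_ (sym (arc-marking c h v w)) (trans (cong (arc c full w v ∧_) (adj-sym h _ _)) (sym (arc-marking c h w v))) ⟩
      starAdjacency c (marking c h) v w                          ≡⟨ adj-star c (marking c h) v w ⟨
      adj (star c (marking c h)) (encode v) (encode w)           ∎
      where
      A : Bool
      A = adj h (encode v) (encode w)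
      in-star : A ≡ true → starAdjacency c full v w ≡ true
      in-star A≡true = trans (sym (adj-star c full v w)) (isSub⇒adj {h = h} {star c full} h⊆star _ _ A≡true)

  I-star≤ : ∀ c g → I g (star c full) ≤ 2 ^ (q * r)
  I-star≤ c g = subst (I g (star c full) ≤_) length-subgraphs
    (I≤length subgraphs λ h h⊆star → subst (_∈ subgraphs) (sym (subgraph-of-star h⊆star))
      (∈-map⁺ (star c) (∈-allMatrices {xs = bools} (marking c h) (λ a j → ∈-bools _))))
    where
    bools : List Bool
    bools = true ∷ false ∷ []
    subgraphs : List (Graph (r + q * b + e))
    subgraphs = map (star c) (allMatrices bools)
    length-subgraphs : length subgraphs ≡ 2 ^ (q * r)
    length-subgraphs = trans (List.length-map (star c) (allMatrices bools)) (length-allMatrices {r = r} {q} bools)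
    ∈-bools : ∀ x → x ∈ bools
    ∈-bools true  = here refl
    ∈-bools false = there (here refl)

  separating-bound : ∀ {S : List (Graph (r + q * b + e))} → Separating S →
                     b ^ (q * r) ≤ suc (2 ^ (q * r)) ^ length S * (r + q * b + e) ^ (r + q * b + e)
  separating-bound {S} separates =
    subst (_≤ suc (2 ^ (q * r)) ^ length S * (r + q * b + e) ^ (r + q * b + e)) length-family
          (separating⇒length≤ separates family⁺ I-family≤)
    where
    family : List (Graph (r + q * b + e))
    family = map (λ c → star c full) (allMatrices (Data.List.allFin b))
    length-family : length family ≡ b ^ (q * r)
    length-family = trans (List.length-map _ (allMatrices {r = r} {q} (Data.List.allFin b)))
                          (trans (length-allMatrices {r = r} {q} _) (cong (_^ (q * r)) (List.length-tabulate id)))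
    family⁺ : Unique family
    family⁺ = Unique.map⁺ star-injective (allMatrices⁺ (Unique.allFin⁺ b))
    I-family≤ : ∀ {x} → x ∈ family → ∀ g → I g x ≤ 2 ^ (q * r)
    I-family≤ x∈family g with ∈-map⁻ _ x∈family
    ... | c , _ , refl = I-star≤ c g

separating-bound : ∀ {n} r q b → r + q * b ≤ n → {S : List (Graph n)} → Separating S →
                   b ^ (q * r) ≤ suc (2 ^ (q * r)) ^ length S * n ^ n
separating-bound r q b fits with m≤n⇒∃[o]m+o≡n fits
... | e , refl = Star.separating-bound r q b e

-- Arithmetic

n<2^n : ∀ n → n < 2 ^ n
n<2^n zero    = s≤s z≤n
n<2^n (suc n) = +-mono-≤ (m^n>0 2 n) (≤-trans (n<2^n n) (m≤m+n (2 ^ n) 0))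

1+2^n≤2^[1+n] : ∀ n → suc (2 ^ n) ≤ 2 ^ suc n
1+2^n≤2^[1+n] n = +-mono-≤ (m^n>0 2 n) (m≤m+n (2 ^ n) 0)

m≤2*[m/n]*n : ∀ m n .{{_ : NonZero n}} → 1 ≤ m / n → m ≤ 2 * (m / n) * n
m≤2*[m/n]*n m n 1≤m/n = begin
  m                         ≡⟨ m≡m%n+[m/n]*n m n ⟩
  m % n + m / n * n         ≤⟨ +-monoˡ-≤ (m / n * n) (<⇒≤ (m%n<n m n)) ⟩
  n + m / n * n             ≤⟨ +-monoˡ-≤ (m / n * n) (m≤n*m n (m / n) {{>-nonZero 1≤m/n}}) ⟩
  m / n * n + m / n * n     ≡⟨ double (m / n) n ⟩
  2 * (m / n) * n           ∎
  where
  open ≤-Reasoning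
  double : ∀ t n → t * n + t * n ≡ 2 * t * n
  double = solve-∀

exponent-gap : ∀ {k M t u n E} → E ≡ t * u → k < M → M ≤ u → M + 6 ≤ t → n ≤ u →
               suc E * k + (5 + M + t) * n < suc M * E
exponent-gap {k} {M} {t} {u} {n} {E} refl k<M M≤u M+6≤t n≤u = begin-strict
  suc E * k + (5 + M + t) * n       ≤⟨ +-monoʳ-≤ (suc E * k) (*-monoʳ-≤ (5 + M + t) n≤u) ⟩
  suc E * k + (5 + M + t) * u       ≡⟨ expand t u k M ⟩
  t * u * k + (k + (5 + M + t) * u) <⟨ +-monoʳ-< (t * u * k) (+-monoˡ-< ((5 + M + t) * u) (<-≤-trans k<M M≤u)) ⟩
  t * u * k + (u + (5 + M + t) * u) ≡⟨ collect t u k M ⟩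
  t * u * k + (M + 6 + t) * u       ≤⟨ +-monoʳ-≤ (t * u * k) (*-monoˡ-≤ u (+-monoˡ-≤ t M+6≤t)) ⟩
  t * u * k + (t + t) * u           ≡⟨ factor t u k ⟩
  (2 + k) * E                       ≤⟨ *-monoˡ-≤ E (s≤s k<M) ⟩
  suc M * E                         ∎
  where
  open ≤-Reasoning
  expand : ∀ t u k M → suc (t * u) * k + (5 + M + t) * u ≡ t * u * k + (k + (5 + M + t) * u)
  expand = solve-∀
  collect : ∀ t u k M → t * u * k + (u + (5 + M + t) * u) ≡ t * u * k + (M + 6 + t) * u
  collect = solve-∀
  factor : ∀ t u k → t * u * k + (t + t) * u ≡ (2 + k) * (t * u)
  factor = solve-∀

power-gap : ∀ {M t k n} → k < M → M + 6 ≤ t → n ≤ 2 * t * (8 * 2 ^ suc M) →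
            suc (2 ^ (4 * t * (4 * t * 2 ^ suc M))) ^ k * n ^ n < (2 ^ suc M) ^ (4 * t * (4 * t * 2 ^ suc M))
power-gap {M} {t} {k} {n} k<M M+6≤t n≤u = begin-strict
  suc (2 ^ E) ^ k * n ^ n           ≤⟨ *-mono-≤ (^-monoˡ-≤ k (1+2^n≤2^[1+n] E)) (^-monoˡ-≤ n (<⇒≤ n<2^L)) ⟩
  (2 ^ suc E) ^ k * (2 ^ L) ^ n     ≡⟨ cong₂ _*_ (^-*-assoc 2 (suc E) k) (^-*-assoc 2 L n) ⟩
  2 ^ (suc E * k) * 2 ^ (L * n)     ≡⟨ ^-distribˡ-+-* 2 (suc E * k) (L * n) ⟨
  2 ^ (suc E * k + L * n)           <⟨ ^-monoʳ-< 2 (s≤s (s≤s z≤n)) (exponent-gap E≡tu k<M M≤u M+6≤t n≤u) ⟩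
  2 ^ (suc M * E)                   ≡⟨ ^-*-assoc 2 (suc M) E ⟨
  (2 ^ suc M) ^ E                   ∎
  where
  open ≤-Reasoning
  E u L : ℕ
  E = 4 * t * (4 * t * 2 ^ suc M)
  u = 2 * t * (8 * 2 ^ suc M)
  L = 5 + M + t
  E≡tu : E ≡ t * u
  E≡tu = lemma t (2 ^ M)
    where
    lemma : ∀ t x → 4 * t * (4 * t * (2 * x)) ≡ t * (2 * t * (8 * (2 * x)))
    lemma = solve-∀
  u≡2^[5+M]*t : u ≡ 2 ^ (5 + M) * t
  u≡2^[5+M]*t = lemma t (2 ^ M)
    where
    lemma : ∀ t x → 2 * t * (8 * (2 * x)) ≡ 2 * (2 * (2 * (2 * (2 * x)))) * t
    lemma = solve-∀
  M≤u : M ≤ u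
  M≤u = begin
    M               ≤⟨ ≤-trans (m≤m+n M 6) M+6≤t ⟩
    t               ≤⟨ m≤n*m t (2 ^ (5 + M)) {{m^n≢0 2 (5 + M)}} ⟩
    2 ^ (5 + M) * t ≡⟨ u≡2^[5+M]*t ⟨
    u               ∎
  n<2^L : n < 2 ^ L
  n<2^L = begin-strict
    n                   ≤⟨ n≤u ⟩
    u                   ≡⟨ u≡2^[5+M]*t ⟩
    2 ^ (5 + M) * t     <⟨ *-monoʳ-< (2 ^ (5 + M)) {{m^n≢0 2 (5 + M)}} (n<2^n t) ⟩
    2 ^ (5 + M) * 2 ^ t ≡⟨ ^-distribˡ-+-* 2 (5 + M) t ⟨
    2 ^ L               ∎

corollary23 : (M : ℕ) → ∃[ N ] ((n : ℕ) → N ≤ n → (S : List (Graph n)) → ((x y : Graph n) → All (λ g → I g x ≡ I g y) S → x ≅ y) → M ≤ length S)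
corollary23 M = (M + 6) * (8 * b) , bound
  where
  b : ℕ
  b = 2 ^ suc M
  instance
    8b≢0 : NonZero (8 * b)
    8b≢0 = m*n≢0 8 b {{_}} {{m^n≢0 2 (suc M)}}
  bound : (n : ℕ) → (M + 6) * (8 * b) ≤ n → (S : List (Graph n)) → Separating S → M ≤ length S
  bound n N≤n S separates with M ≤? length S
  ... | yes M≤k = M≤k
  ... | no  M≰k = contradiction (separating-bound (4 * t * b) (4 * t) b fits separates)
                                (<⇒≱ (power-gap (≰⇒> M≰k) M+6≤t n≤2t8b))
    where
    t : ℕ
    t = n / (8 * b)
    M+6≤t : M + 6 ≤ t
    M+6≤t = subst (_≤ t) (m*n/n≡m (M + 6) (8 * b)) (/-monoˡ-≤ (8 * b) N≤n)
    fits : 4 * t * b + 4 * t * b ≤ n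
    fits = subst (_≤ n) (eq t b) (m/n*n≤m n (8 * b))
      where
      eq : ∀ t b → t * (8 * b) ≡ 4 * t * b + 4 * t * b
      eq = solve-∀
    n≤2t8b : n ≤ 2 * t * (8 * b)
    n≤2t8b = m≤2*[m/n]*n n (8 * b) (≤-trans (≤-trans (s≤s z≤n) (m≤n+m 6 M)) M+6≤t)
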